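{- Let $k$ and $c$ be positive integers, let $G$ be a finite simple graph of order $n$, and let $L \subseteq V(G)$. Let $C_{1},\dots,C_{k}$ be $k$ vertex-disjoint $c$-chorded cycles in $G$, each with a fixed orientation, such that $C^{*} := \bigcup_{p=1}^{k} C_{p}$ is not a spanning subgraph of $G$, and suppose that among all such families of $k$ vertex-disjoint $c$-chorded cycles, $C_{1},\dots,C_{k}$ are chosen so that (A1) $|V(C^{*}) \cap L|$ is as large as possible, and (A2) subject to (A1), $|V(C^{*})|$ is as large as possible. Let $H^{*} = G - V(C^{*})$ and let $H$ be a component of $H^{*}$. Let $C = C_{p}$ for some $1 \le p \le k$, let $v \in N_{C}(H)$ and $x \in V(H)$. Then (i) $v^{+}x \notin E(G)$, and (ii) $d_{H^{*} \cup C}(v^{+}) + d_{H^{*} \cup C}(x) \le |V(H^{*}) \cup V(C)| - 1$.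
   Context: A cycle $C$ in $G$ is $c$-chorded if $|E(G[V(C)]) \setminus E(C)| \ge c$. For $v \in V(G)$ and $X \subseteq V(G)$, $N_{X}(v) = N_{G}(v) \cap X$ and $d_{X}(v) = |N_{X}(v)|$; for a set $V$ of vertices, $N_{X}(V) = \bigcup_{v \in V} N_{X}(v)$; subgraphs are identified with their vertex sets, so $N_{C}(H)$ is the set of vertices of $C$ having a neighbor in $H$ and $H^{*} \cup C$ denotes the vertex set $V(H^{*}) \cup V(C)$. For an oriented cycle $C$ and $v \in V(C)$, $v^{+}$ denotes the successor of $v$ on $C$. -}

module Defs where

open import Data.Nat using (ℕ; zero; suc; _+_; _≤_; _<ᵇ_)
import Data.Nat as N
open import Data.Bool using (Bool; true; false; if_then_else_; _∧_; _∨_; not)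
open import Data.Fin using (Fin; zero; suc; toℕ; lower₁; _≟_)
open import Data.Product using (Σ; ∃; _×_; _,_)
open import Relation.Nullary using (¬_; yes; no; does)
open import Relation.Binary.PropositionalEquality using (_≡_; _≢_)
open import Function.Definitions using (Injective)

record Graph (n : ℕ) : Set where
  field
    E      : Fin n → Fin n → Bool
    symm   : ∀ u v → E u v ≡ E v u
    irrefl : ∀ u → E u u ≡ false
open Graph public

sumFin : ∀ {m} → (Fin m → ℕ) → ℕ
sumFin {zero}  f = 0
sumFin {suc m} f = f zero + sumFin (λ i → f (suc i))

count : ∀ {m} → (Fin m → Bool) → ℕ
count f = sumFin (λ i → if f i then 1 else 0)

anyFin : ∀ {m} → (Fin m → Bool) → Bool
anyFin {zero}  f = false
anyFin {suc m} f = f zero ∨ anyFin (λ i → f (suc i))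

_==_ : ∀ {n} → Fin n → Fin n → Bool
u == v = does (u ≟ v)

-- successor index on a cyclically ordered Fin (suc m)
next : ∀ {m} → Fin (suc m) → Fin (suc m)
next {m} i with m N.≟ toℕ i
... | yes _ = zero
... | no ne = suc (lower₁ i ne)

-- An oriented cycle of G: vertices vert 0, vert 1, ..., vert (3+len-1),
-- pairwise distinct, consecutive ones (cyclically) adjacent.
-- The orientation is the order of the indices; the successor of vert i is vert (next i).
record Cycle {n : ℕ} (G : Graph n) : Set where
  field
    len  : ℕ
    vert : Fin (3 + len) → Fin n
    inj  : Injective _≡_ _≡_ vert
    edge : ∀ i → E G (vert i) (vert (next i)) ≡ true
open Cycle public

module _ {n : ℕ} {G : Graph n} where
  inC : Cycle G → Fin n → Bool
  inC C v = anyFin (λ i → vert C i == v)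

  cycEdge : Cycle G → Fin n → Fin n → Bool
  cycEdge C u w = anyFin (λ i →
    (vert C i == u ∧ vert C (next i) == w) ∨ (vert C i == w ∧ vert C (next i) == u))

  -- |E(G[V(C)]) \ E(C)|  (unordered pairs counted once via toℕ u < toℕ w)
  chords : Cycle G → ℕ
  chords C = sumFin (λ u → count (λ w →
    (toℕ u <ᵇ toℕ w) ∧ inC C u ∧ inC C w ∧ E G u w ∧ not (cycEdge C u w)))

  Chorded : ℕ → Cycle G → Set
  Chorded c C = c ≤ chords C

  Family : (k : ℕ) → ℕ → (Fin k → Cycle G) → Set
  Family k c F = (∀ p → Chorded c (F p))
               × (∀ p q → p ≢ q → ∀ v → inC (F p) v ≡ true → inC (F q) v ≡ false)

  inStar : ∀ {k} → (Fin k → Cycle G) → Fin n → Bool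
  inStar F v = anyFin (λ p → inC (F p) v)

  scoreL : ∀ {k} → (Fin n → Bool) → (Fin k → Cycle G) → ℕ
  scoreL L F = count (λ v → inStar F v ∧ L v)

  size : ∀ {k} → (Fin k → Cycle G) → ℕ
  size F = count (inStar F)

  deg : (Fin n → Bool) → Fin n → ℕ
  deg X v = count (λ w → X w ∧ E G v w)

  data ConnIn (S : Fin n → Bool) : Fin n → Fin n → Set where
    here : ∀ {u} → S u ≡ true → ConnIn S u u
    step : ∀ {u w x} → S u ≡ true → E G u w ≡ true → ConnIn S w x → ConnIn S u x

  IsComponent : (Fin n → Bool) → (Fin n → Bool) → Set
  IsComponent S H = (∃ λ h → H h ≡ true)
                  × (∀ v → H v ≡ true → S v ≡ true)
                  × (∀ u w → H u ≡ true → H w ≡ true → ConnIn H u w)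
                  × (∀ u w → H u ≡ true → S w ≡ true → E G u w ≡ true → H w ≡ true)

module Submission where

-- Everything rests on one exchange principle (Extremal.no-absorption): a closed walk
-- passing once through every vertex of C and of a path P ⊆ H attached to C is a cycle
-- C′ with at least as many chords as C (GraphFacts.absorb: G[V(C′)] gains at least one
-- edge per vertex of P while C′ gains exactly |P| cycle edges), so replacing C by C′
-- would contradict the choice (A1), (A2).  Part (i) applies it to the walk v⁺ … v, a,
-- (path in H), b, v⁺.  For (ii), the same principle shows that x ~ vert C j and
-- v⁺ ~ (vert C j)⁺ never hold together, and within H* the neighbours of x lie in H,
-- where v⁺ has none; summing these exclusions over the vertices gives (ii).

open import Defs
open import Data.Nat using (ℕ; zero; suc; _≤_; _<_; _+_; _∸_; z≤n; s≤s; _<ᵇ_)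
import Data.Nat as ℕ
open import Data.Nat.Properties
open import Data.Bool using (Bool; true; false; not; _∨_; _∧_; if_then_else_)
open import Data.Bool.Properties
  using (not-injective; ¬-not; T-≡; ∨-comm; ∨-zeroʳ; ∧-comm; ∧-zeroʳ; ∧-identityʳ; ∧-distribʳ-∨;
         ∧-conicalˡ; ∧-conicalʳ)
open import Data.Fin using (Fin; zero; suc; toℕ)
open import Data.List using (List; []; _∷_; _++_; reverse; length; lookup; tabulate; [_])
import Data.Fin as Fin
import Data.Fin.Properties as FinP
import Data.List.Properties as ListP
open import Data.Unit using (⊤; tt)
open import Data.List.Membership.Propositional using (_∈_)
open import Data.List.Membership.Propositional.Properties
  using (∈-lookup; ∈-∃++; ∈-++⁺ˡ; ∈-++⁺ʳ; ∈-++⁻; ∈-tabulate⁺; ∈-tabulate⁻)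
open import Data.List.Relation.Unary.Any as Any using (here; there; any?)
open import Data.List.Relation.Unary.Any.Properties using (lookup-index)
open import Data.List.Relation.Unary.All as All using ([])
open import Data.List.Relation.Unary.All.Properties using (¬Any⇒All¬)
open import Data.List.Relation.Unary.Unique.Propositional using (Unique; []; _∷_)
import Data.List.Relation.Unary.Unique.Propositional.Properties as UniqueP
open import Data.List.Relation.Binary.Permutation.Propositional
  using (_↭_; ↭-refl; ↭-sym; ↭-trans; ↭⇒↭ₛ; module PermutationReasoning)
open import Data.List.Relation.Binary.Permutation.Propositional.Properties
  using (∈-resp-↭; ↭-length; ++-comm; ++⁺ˡ; ++⁺ʳ; ↭-reverse)
import Data.List.Relation.Binary.Permutation.Setoid.Properties as PermS
open import Data.Product using (Σ; ∃; ∃₂; _×_; _,_; proj₁; proj₂)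
open import Data.Sum using (_⊎_; inj₁; inj₂)
open import Data.Empty using (⊥; ⊥-elim)
open import Function using (_∘_; case_of_; _⇔_; mk⇔; module Equivalence)
open Equivalence using (to; from)
open import Function.Definitions using (Injective)
open import Relation.Nullary using (yes; no)
open import Relation.Nullary.Decidable using (dec-true; dec-false)
open import Relation.Binary using (tri<; tri≈; tri>)
open import Relation.Binary.PropositionalEquality hiding ([_])
open import Algebra.Properties.CommutativeSemigroup +-commutativeSemigroup using (interchange)

true≢false : true ≢ false
true≢false ()

==⇒≡ : ∀ {n} {u w : Fin n} → (u == w) ≡ true → u ≡ w
==⇒≡ {u = u} {w} e with u Fin.≟ w
... | yes u≡w = u≡w
==⇒≡ () | no _

==-refl : ∀ {n} (u : Fin n) → (u == u) ≡ true
==-refl u = dec-true (u Fin.≟ u) refl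

∧-monoˡ : ∀ c {a b} → (a ≡ true → b ≡ true) → a ∧ c ≡ true → b ∧ c ≡ true
∧-monoˡ c {true} a⇒b e rewrite a⇒b refl = e

∧-monoʳ : ∀ a {b c} → (b ≡ true → c ≡ true) → a ∧ b ≡ true → a ∧ c ≡ true
∧-monoʳ true b⇒c = b⇒c

ind : Bool → ℕ
ind b = if b then 1 else 0

ind≤1 : ∀ b → ind b ≤ 1
ind≤1 true  = ≤-refl
ind≤1 false = z≤n

ind-mono : ∀ {a b} → (a ≡ true → b ≡ true) → ind a ≤ ind b
ind-mono {false} a⇒b = z≤n
ind-mono {true}  a⇒b rewrite a⇒b refl = ≤-refl

ind-∨ : ∀ a b → (a ≡ true → b ≡ false) → ind (a ∨ b) ≡ ind a + ind b
ind-∨ true  b a⇒¬b rewrite a⇒¬b refl = refl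
ind-∨ false b a⇒¬b = refl

ind-split : ∀ a b e → (e ≡ true → b ≡ true) → ind (a ∧ b ∧ not e) + ind (a ∧ e) ≡ ind (a ∧ b)
ind-split false b     e     e⇒b = refl
ind-split true  true  false e⇒b = refl
ind-split true  true  true  e⇒b = refl
ind-split true  false false e⇒b = refl
ind-split true  false true  e⇒b = case e⇒b refl of λ ()

-- Vertex sets are Boolean predicates on Fin n; `u ≺ w` orders the vertices so that
-- each unordered pair {u, w} is counted once, as the pair with u ≺ w.

_≺_ : ∀ {n} → Fin n → Fin n → Bool
u ≺ w = toℕ u <ᵇ toℕ w

_⊆_ : ∀ {n} → (Fin n → Bool) → (Fin n → Bool) → Set
S ⊆ T = ∀ t → S t ≡ true → T t ≡ true

insert : ∀ {n} → Fin n → (Fin n → Bool) → Fin n → Bool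
insert p S t = S t ∨ (p == t)

insert-⊇ : ∀ {n} (S : Fin n → Bool) p → S ⊆ insert p S
insert-⊇ S p t St rewrite St = refl

insert-∋ : ∀ {n} (S : Fin n → Bool) p → insert p S p ≡ true
insert-∋ S p rewrite ==-refl p = ∨-zeroʳ (S p)

insert-⊆ : ∀ {n} {S T : Fin n → Bool} {p} → S ⊆ T → T p ≡ true → insert p S ⊆ T
insert-⊆ {S = S} {T} {p} S⊆T Tp t e with S t in St | p == t in p≡t
... | true  | _    = S⊆T t St
... | false | true = subst (λ z → T z ≡ true) (==⇒≡ {u = p} p≡t) Tp

sumFin-cong : ∀ {m} {f g : Fin m → ℕ} → (∀ i → f i ≡ g i) → sumFin f ≡ sumFin g
sumFin-cong {zero}  f≗g = refl
sumFin-cong {suc m} f≗g = cong₂ _+_ (f≗g zero) (sumFin-cong (λ i → f≗g (suc i)))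

sumFin-mono : ∀ {m} {f g : Fin m → ℕ} → (∀ i → f i ≤ g i) → sumFin f ≤ sumFin g
sumFin-mono {zero}  f≤g = z≤n
sumFin-mono {suc m} f≤g = +-mono-≤ (f≤g zero) (sumFin-mono (λ i → f≤g (suc i)))

sumFin-strict : ∀ {m} {f g : Fin m → ℕ} → (∀ i → f i ≤ g i) → (j : Fin m) → f j < g j
  → sumFin f < sumFin g
sumFin-strict {suc m} f≤g zero    fj<gj = +-mono-<-≤ fj<gj (sumFin-mono (λ i → f≤g (suc i)))
sumFin-strict {suc m} f≤g (suc j) fj<gj =
  +-mono-≤-< (f≤g zero) (sumFin-strict (λ i → f≤g (suc i)) j fj<gj)

sumFin-+ : ∀ {m} (f g : Fin m → ℕ) → sumFin (λ i → f i + g i) ≡ sumFin f + sumFin g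
sumFin-+ {zero}  f g = refl
sumFin-+ {suc m} f g = trans
  (cong (f zero + g zero +_) (sumFin-+ (λ i → f (suc i)) (λ i → g (suc i))))
  (interchange (f zero) (g zero) (sumFin (λ i → f (suc i))) (sumFin (λ i → g (suc i))))

sumFin-zero : ∀ {m} {f : Fin m → ℕ} → (∀ i → f i ≡ 0) → sumFin f ≡ 0
sumFin-zero {zero}  f≗0 = refl
sumFin-zero {suc m} f≗0 = cong₂ _+_ (f≗0 zero) (sumFin-zero (λ i → f≗0 (suc i)))

sumFin-ones : ∀ m → sumFin {m} (λ _ → 1) ≡ m
sumFin-ones zero    = refl
sumFin-ones (suc m) = cong suc (sumFin-ones m)

sumFin-single : ∀ {m} (f : Fin m → ℕ) (t : Fin m) → (∀ i → i ≢ t → f i ≡ 0) → sumFin f ≡ f t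
sumFin-single {suc m} f zero    f≗0 =
  trans (cong (f zero +_) (sumFin-zero (λ i → f≗0 (suc i) (λ ())))) (+-identityʳ _)
sumFin-single {suc m} f (suc t) f≗0 = cong₂ _+_ (f≗0 zero (λ ()))
  (sumFin-single (λ i → f (suc i)) t (λ i i≢t → f≗0 (suc i) (i≢t ∘ FinP.suc-injective)))

sumFin-swap : ∀ {m k} (f : Fin m → Fin k → ℕ)
  → sumFin (λ u → sumFin (λ i → f u i)) ≡ sumFin (λ i → sumFin (λ u → f u i))
sumFin-swap {zero} {k} f = sym (sumFin-zero {k} (λ _ → refl))
sumFin-swap {suc m} f = trans
  (cong (sumFin (f zero) +_) (sumFin-swap (λ u → f (suc u))))
  (sym (sumFin-+ (f zero) (λ i → sumFin (λ u → f (suc u) i))))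

anyFin⇒∃ : ∀ {m} (f : Fin m → Bool) → anyFin f ≡ true → ∃ λ i → f i ≡ true
anyFin⇒∃ {suc m} f e with f zero in f0
... | true  = zero , f0
... | false with anyFin⇒∃ (λ i → f (suc i)) e
...   | i , fi = suc i , fi

∃⇒anyFin : ∀ {m} (f : Fin m → Bool) (i : Fin m) → f i ≡ true → anyFin f ≡ true
∃⇒anyFin f zero    fi rewrite fi = refl
∃⇒anyFin f (suc i) fi with f zero
... | true  = refl
... | false = ∃⇒anyFin (λ j → f (suc j)) i fi

anyFin-false : ∀ {m} (f : Fin m → Bool) → (∀ i → f i ≡ false) → anyFin f ≡ false
anyFin-false {zero}  f f≗false = refl
anyFin-false {suc m} f f≗false rewrite f≗false zero =
  anyFin-false (λ i → f (suc i)) (λ i → f≗false (suc i))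

∧-anyFin : ∀ {m} a (f : Fin m → Bool) → a ∧ anyFin f ≡ anyFin (λ i → a ∧ f i)
∧-anyFin true  f = refl
∧-anyFin {m} false f = sym (anyFin-false {m} _ (λ _ → refl))

anyFin-surjective : ∀ {m} (f : Fin m → Bool) (σ : Fin m → Fin m) → (∀ j → ∃ λ i → σ i ≡ j)
  → anyFin (f ∘ σ) ≡ anyFin f
anyFin-surjective f σ onto with anyFin f in any-f | anyFin (f ∘ σ) in any-fσ
... | true  | true  = refl
... | false | false = refl
... | true  | false = let j , fj = anyFin⇒∃ f any-f ; i , σi≡j = onto j in
  sym (trans (sym (∃⇒anyFin (f ∘ σ) i (subst (λ z → f z ≡ true) (sym σi≡j) fj))) any-fσ)
... | false | true  = let i , fσi = anyFin⇒∃ (f ∘ σ) any-fσ in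
  trans (sym (∃⇒anyFin f (σ i) fσi)) any-f

count-mono : ∀ {n} (f g : Fin n → Bool) → f ⊆ g → count f ≤ count g
count-mono f g f⊆g = sumFin-mono (λ w → ind-mono (f⊆g w))

count-∨ : ∀ {n} (f g : Fin n → Bool) → (∀ w → f w ≡ true → g w ≡ false)
  → count (λ w → f w ∨ g w) ≡ count f + count g
count-∨ {n} f g disjoint =
  trans (sumFin-cong (λ w → ind-∨ (f w) (g w) (disjoint w))) (sumFin-+ {n} _ _)

count-⋁ : ∀ {n m} (g : Fin m → Fin n → Bool)
  → (∀ i j w → i ≢ j → g i w ≡ true → g j w ≡ false)
  → count (λ w → anyFin (λ i → g i w)) ≡ sumFin (λ i → count (g i))
count-⋁ {n} {zero}  g disjoint = sumFin-zero {n} (λ _ → refl)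
count-⋁ {n} {suc m} g disjoint = trans
  (count-∨ (g zero) (λ w → anyFin (λ i → g (suc i) w))
    (λ w g0w → anyFin-false _ (λ i → disjoint zero (suc i) w (λ ()) g0w)))
  (cong (count (g zero) +_) (count-⋁ (λ i → g (suc i))
    (λ i j w i≢j → disjoint (suc i) (suc j) w (i≢j ∘ FinP.suc-injective))))

count-single : ∀ {n} (f : Fin n → Bool) (t : Fin n) → (∀ w → f w ≡ true → w ≡ t)
  → count f ≡ ind (f t)
count-single f t only-t = sumFin-single _ t vanish
  where
  vanish : ∀ w → w ≢ t → ind (f w) ≡ 0
  vanish w w≢t with f w in fw
  ... | true  = ⊥-elim (w≢t (only-t w fw))
  ... | false = refl

count₂-single : ∀ {n} (h : Fin n → Fin n → Bool) (s t : Fin n)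
  → (∀ u w → h u w ≡ true → u ≡ s × w ≡ t) → h s t ≡ true → sumFin (λ u → count (h u)) ≡ 1
count₂-single h s t only present = trans (sumFin-single _ s vanish)
  (trans (count-single (h s) t (λ w e → proj₂ (only s w e))) (cong ind present))
  where
  vanish : ∀ u → u ≢ s → count (h u) ≡ 0
  vanish u u≢s = sumFin-zero (λ w → cong ind (¬-not (λ e → u≢s (proj₁ (only u w e)))))

count-image : ∀ {m n} (f : Fin m → Fin n) → Injective _≡_ _≡_ f → (Q : Fin n → Bool)
  → count (λ w → anyFin (λ j → f j == w) ∧ Q w) ≡ count (λ j → Q (f j))
count-image f f-inj Q = begin
  count (λ w → anyFin (λ j → f j == w) ∧ Q w)
    ≡⟨ sumFin-cong (λ w → cong ind (trans (∧-comm _ (Q w)) (∧-anyFin (Q w) (λ j → f j == w)))) ⟩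
  count (λ w → anyFin (λ j → Q w ∧ (f j == w)))
    ≡⟨ count-⋁ (λ j w → Q w ∧ (f j == w)) disjoint ⟩
  sumFin (λ j → count (λ w → Q w ∧ (f j == w)))
    ≡⟨ sumFin-cong (λ j → count-single _ (f j) (λ w e → sym (==⇒≡ (∧-conicalʳ _ _ e)))) ⟩
  sumFin (λ j → ind (Q (f j) ∧ (f j == f j)))
    ≡⟨ sumFin-cong (λ j → cong (λ b → ind (Q (f j) ∧ b)) (==-refl (f j))) ⟩
  sumFin (λ j → ind (Q (f j) ∧ true))
    ≡⟨ sumFin-cong (λ j → cong ind (∧-identityʳ (Q (f j)))) ⟩
  count (λ j → Q (f j)) ∎
  where
  open ≡-Reasoning
  disjoint : ∀ i j w → i ≢ j → Q w ∧ (f i == w) ≡ true → Q w ∧ (f j == w) ≡ false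
  disjoint i j w i≢j ei = ¬-not (λ ej →
    i≢j (f-inj (trans (==⇒≡ (∧-conicalʳ _ _ ei)) (sym (==⇒≡ (∧-conicalʳ _ _ ej))))))

next-cases : ∀ {m} (i : Fin (suc m))
  → (toℕ i ≡ m × next i ≡ zero) ⊎ (toℕ i ≢ m × toℕ (next i) ≡ suc (toℕ i))
next-cases {m} i with m ℕ.≟ toℕ i
... | yes m≡i = inj₁ (sym m≡i , refl)
... | no  m≢i = inj₂ (m≢i ∘ sym , cong suc (FinP.toℕ-lower₁ i m≢i))

next-inject₁ : ∀ {m} (j : Fin m) → next (Fin.inject₁ j) ≡ suc j
next-inject₁ {m} j with next-cases (Fin.inject₁ j)
... | inj₁ (j≡m , _) = ⊥-elim (<-irrefl (trans (sym (FinP.toℕ-inject₁ j)) j≡m) (FinP.toℕ<n j))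
... | inj₂ (_ , e)   = FinP.toℕ-injective (trans e (cong suc (FinP.toℕ-inject₁ j)))

next-fromℕ : ∀ m → next (Fin.fromℕ m) ≡ zero
next-fromℕ m with next-cases (Fin.fromℕ m)
... | inj₁ (_ , e)    = e
... | inj₂ (last≢m , _) = ⊥-elim (last≢m (FinP.toℕ-fromℕ m))

next-surjective : ∀ {m} (j : Fin (suc m)) → ∃ λ i → next i ≡ j
next-surjective {m} zero    = Fin.fromℕ m , next-fromℕ m
next-surjective     (suc j) = Fin.inject₁ j , next-inject₁ j

next-injective : ∀ {m} {i j : Fin (suc m)} → next i ≡ next j → i ≡ j
next-injective {m} {i} {j} e with next-cases i | next-cases j
... | inj₁ (i≡m , _)  | inj₁ (j≡m , _)  = FinP.toℕ-injective (trans i≡m (sym j≡m))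
... | inj₁ (_ , i⁺≡0) | inj₂ (_ , j⁺)   = ⊥-elim (0≢1+n (trans (cong toℕ (trans (sym i⁺≡0) e)) j⁺))
... | inj₂ (_ , i⁺)   | inj₁ (_ , j⁺≡0) = ⊥-elim (0≢1+n (trans (cong toℕ (trans (sym j⁺≡0) (sym e))) i⁺))
... | inj₂ (_ , i⁺)   | inj₂ (_ , j⁺)   =
  FinP.toℕ-injective (suc-injective (trans (sym i⁺) (trans (cong toℕ e) j⁺)))

next-next≢ : ∀ {m} → 2 ≤ m → (i : Fin (suc m)) → next (next i) ≢ i
next-next≢ {m} 2≤m i e with next-cases i | next-cases (next i)
... | inj₁ (i≡m , i⁺≡0) | inj₁ (i⁺≡m , _) =
  <-irrefl (trans (cong toℕ (sym i⁺≡0)) i⁺≡m) (≤-trans (s≤s z≤n) 2≤m)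
... | inj₁ (i≡m , i⁺≡0) | inj₂ (_ , i⁺⁺) =
  <-irrefl (trans (sym (trans (trans (cong toℕ (sym e)) i⁺⁺) (cong (suc ∘ toℕ) i⁺≡0))) i≡m) 2≤m
... | inj₂ (_ , i⁺) | inj₁ (i⁺≡m , i⁺⁺≡0) =
  <-irrefl (sym (trans (sym i⁺≡m) (trans i⁺ (cong suc (cong toℕ (trans (sym e) i⁺⁺≡0)))))) 2≤m
... | inj₂ (_ , i⁺) | inj₂ (_ , i⁺⁺) =
  k≢2+k (trans (sym (cong toℕ e)) (trans i⁺⁺ (cong suc i⁺)))
  where
  k≢2+k : ∀ {k} → k ≢ suc (suc k)
  k≢2+k ()

module _ {A : Set} where

  Walk : (A → A → Set) → A → List A → Set
  Walk R a []       = ⊤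
  Walk R a (b ∷ bs) = R a b × Walk R b bs

  end : A → List A → A
  end a []       = a
  end a (b ∷ bs) = end b bs

  end-++ : ∀ a xs ys → end a (xs ++ ys) ≡ end (end a xs) ys
  end-++ a []       ys = refl
  end-++ a (x ∷ xs) ys = end-++ x xs ys

  end-reverse : ∀ a b bs → end a (reverse (b ∷ bs)) ≡ b
  end-reverse a b bs rewrite ListP.unfold-reverse b bs = end-++ a (reverse bs) [ b ]

  Walk-++ : ∀ {R} a xs ys → Walk R a xs → Walk R (end a xs) ys → Walk R a (xs ++ ys)
  Walk-++ a []       ys _          w₂ = w₂
  Walk-++ a (x ∷ xs) ys (r , w₁) w₂ = r , Walk-++ x xs ys w₁ w₂

  Walk-++⁻ : ∀ {R} a xs ys → Walk R a (xs ++ ys) → Walk R a xs × Walk R (end a xs) ys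
  Walk-++⁻ a []       ys w       = tt , w
  Walk-++⁻ a (x ∷ xs) ys (r , w) = let w₁ , w₂ = Walk-++⁻ x xs ys w in (r , w₁) , w₂

  Walk-map : ∀ {R S : A → A → Set} → (∀ {x y} → R x y → S x y) → ∀ a xs → Walk R a xs → Walk S a xs
  Walk-map f a []       _       = tt
  Walk-map f a (x ∷ xs) (r , w) = f r , Walk-map f x xs w

  Walk-reverse : ∀ {R} → (∀ {x y} → R x y → R y x) → ∀ a b bs
    → Walk R b bs → R a (end b bs) → Walk R a (reverse (b ∷ bs))
  Walk-reverse sym-R a b []       _        r = r , tt
  Walk-reverse {R} sym-R a b (c ∷ cs) (rbc , w) r rewrite ListP.unfold-reverse b (c ∷ cs) =
    Walk-++ a (reverse (c ∷ cs)) [ b ] (Walk-reverse sym-R a c cs w r)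
      (subst (λ z → R z b) (sym (end-reverse a c cs)) (sym-R rbc) , tt)

  Walk-tabulate : ∀ {R} {m} (f : Fin (suc m) → A) → (∀ j → R (f (Fin.inject₁ j)) (f (suc j)))
    → Walk R (f zero) (tabulate (f ∘ suc))
  Walk-tabulate {m = zero}  f steps = tt
  Walk-tabulate {m = suc m} f steps = steps zero , Walk-tabulate (f ∘ suc) (steps ∘ suc)

  end-tabulate : ∀ {m} (f : Fin (suc m) → A) → end (f zero) (tabulate (f ∘ suc)) ≡ f (Fin.fromℕ m)
  end-tabulate {zero}  f = refl
  end-tabulate {suc m} f = end-tabulate (f ∘ suc)

  rotate : ∀ {R} a as b zs → Walk R a (as ++ b ∷ zs) → R (end a (as ++ b ∷ zs)) a
    → Walk R b (zs ++ a ∷ as) × R (end b (zs ++ a ∷ as)) b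
  rotate {R} a as b zs walk close =
    Walk-++ b zs (a ∷ as) walk-zs (subst (λ z → R z a) (end-++ a as (b ∷ zs)) close , walk-as) ,
    subst (λ z → R z b) (sym (end-++ b zs (a ∷ as))) to-b
    where
    walk-as = proj₁ (Walk-++⁻ a as (b ∷ zs) walk)
    to-b    = proj₁ (proj₂ (Walk-++⁻ a as (b ∷ zs) walk))
    walk-zs = proj₂ (proj₂ (Walk-++⁻ a as (b ∷ zs) walk))

  split-at : ∀ {t} a xs → t ∈ a ∷ xs → ∃₂ λ as zs → xs ≡ as ++ zs × end a as ≡ t
  split-at a xs       (here refl) = [] , xs , refl , refl
  split-at a (x ∷ xs) (there t∈)  =
    let as , zs , xs≡ , ends = split-at x xs t∈ in x ∷ as , zs , cong (x ∷_) xs≡ , ends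

Unique-resp-↭ : ∀ {A : Set} {xs ys : List A} → xs ↭ ys → Unique xs → Unique ys
Unique-resp-↭ {A} xs↭ys = PermS.Unique-resp-↭ (setoid A) (↭⇒↭ₛ xs↭ys)

Unique-++⁻ʳ : ∀ {A : Set} (xs : List A) {ys} → Unique (xs ++ ys) → Unique ys
Unique-++⁻ʳ []       u       = u
Unique-++⁻ʳ (x ∷ xs) (_ ∷ u) = Unique-++⁻ʳ xs u

splice-↭ : ∀ {A : Set} (u : A) as xs zs → u ∷ as ++ xs ++ reverse zs ↭ (u ∷ as ++ zs) ++ xs
splice-↭ u as xs zs = begin
  u ∷ as ++ xs ++ reverse zs  ↭⟨ ++⁺ˡ (u ∷ as) (++⁺ˡ xs (↭-reverse zs)) ⟩
  u ∷ as ++ xs ++ zs          ↭⟨ ++⁺ˡ (u ∷ as) (++-comm xs zs) ⟩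
  u ∷ as ++ zs ++ xs          ≡⟨ sym (ListP.++-assoc (u ∷ as) zs xs) ⟩
  (u ∷ as ++ zs) ++ xs        ∎
  where open PermutationReasoning

lookup-injective : ∀ {A : Set} {xs : List A} → Unique xs → ∀ i j → lookup xs i ≡ lookup xs j → i ≡ j
lookup-injective (_ ∷ _)   zero    zero    _ = refl
lookup-injective (x∉ ∷ _)  zero    (suc j) e = ⊥-elim (All.lookup x∉ (∈-lookup j) e)
lookup-injective (x∉ ∷ _)  (suc i) zero    e = ⊥-elim (All.lookup x∉ (∈-lookup i) (sym e))
lookup-injective (_ ∷ u)   (suc i) (suc j) e = cong suc (lookup-injective u i j e)

module GraphFacts {n : ℕ} (G : Graph n) where

  Adj : Fin n → Fin n → Set
  Adj u w = E G u w ≡ true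

  adj-sym : ∀ {u w} → Adj u w → Adj w u
  adj-sym {u} {w} uw = trans (symm G w u) uw

  adj⇒≢ : ∀ {u w} → Adj u w → u ≢ w
  adj⇒≢ {u} uu refl = true≢false (trans (sym uu) (irrefl G u))

  _within_ : List (Fin n) → (Fin n → Bool) → Set
  xs within S = ∀ {t} → t ∈ xs → S t ≡ true

  Path : (Fin n → Bool) → Fin n → Fin n → Set
  Path S a b = Σ (List (Fin n)) λ ps →
    Walk Adj a ps × end a ps ≡ b × Unique (a ∷ ps) × (a ∷ ps) within S

  loop-erase : ∀ {S a b} → ConnIn {G = G} S a b → Path S a b
  loop-erase {a = a} (here Sa) = [] , tt , refl , [] ∷ [] , λ { (here refl) → Sa }
  loop-erase {S} {u} (step {w = w} Su uw rest) with loop-erase rest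
  ... | ps , walk , ends , uniq , inS with any? (u Fin.≟_) (w ∷ ps)
  ...   | no u∉ = w ∷ ps , (uw , walk) , ends , ¬Any⇒All¬ (w ∷ ps) u∉ ∷ uniq , inS′
    where
    inS′ : (u ∷ w ∷ ps) within S
    inS′ (here refl) = Su
    inS′ (there t∈)  = inS t∈
  ...   | yes u∈ with ∈-∃++ u∈
  ...     | [] , zs , refl = ps , walk , ends , uniq , inS
  ...     | _ ∷ as , zs , refl =
    zs , proj₂ (proj₂ (Walk-++⁻ w as (u ∷ zs) walk)) ,
    trans (sym (end-++ w as (u ∷ zs))) ends ,
    Unique-++⁻ʳ (w ∷ as) uniq , inS ∘ ∈-++⁺ʳ (w ∷ as)

  inducedEdge : (Fin n → Bool) → Fin n → Fin n → Bool
  inducedEdge S u w = S u ∧ S w ∧ E G u w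

  edges : (Fin n → Bool) → ℕ
  edges S = sumFin (λ u → count (λ w → (u ≺ w) ∧ inducedEdge S u w))

  inducedEdge-sym : ∀ S u w → inducedEdge S u w ≡ inducedEdge S w u
  inducedEdge-sym S u w with S u | S w
  ... | true  | true  = symm G u w
  ... | true  | false = refl
  ... | false | true  = refl
  ... | false | false = refl

  inducedEdge-mono : ∀ {S T} → S ⊆ T → ∀ u w → inducedEdge S u w ≡ true → inducedEdge T u w ≡ true
  inducedEdge-mono {S} S⊆T u w e with S u in Su | S w in Sw | e
  ... | true | true | Euw rewrite S⊆T u Su | S⊆T w Sw = Euw

  edge-ind-mono : ∀ {S T} → S ⊆ T → ∀ u w
    → ind ((u ≺ w) ∧ inducedEdge S u w) ≤ ind ((u ≺ w) ∧ inducedEdge T u w)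
  edge-ind-mono S⊆T u w = ind-mono (∧-monoʳ (u ≺ w) (inducedEdge-mono S⊆T u w))

  edges-mono : ∀ {S T} → S ⊆ T → edges S ≤ edges T
  edges-mono S⊆T = sumFin-mono (λ u → sumFin-mono (edge-ind-mono S⊆T u))

  edges-strict-< : ∀ {S T} → S ⊆ T → ∀ u w → toℕ u < toℕ w
    → inducedEdge S u w ≡ false → inducedEdge T u w ≡ true → edges S < edges T
  edges-strict-< {S} {T} S⊆T u w u<w Suw Tuw = sumFin-strict
    (λ u → sumFin-mono (edge-ind-mono S⊆T u)) u
    (sumFin-strict (edge-ind-mono S⊆T u) w new-edge)
    where
    new-edge : ind ((u ≺ w) ∧ inducedEdge S u w) < ind ((u ≺ w) ∧ inducedEdge T u w)
    new-edge rewrite to T-≡ (<⇒<ᵇ u<w) | Suw | Tuw = ≤-refl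

  edges-strict : ∀ {S T} → S ⊆ T → ∀ u w → u ≢ w
    → inducedEdge S u w ≡ false → inducedEdge T u w ≡ true → edges S < edges T
  edges-strict {S} {T} S⊆T u w u≢w Suw Tuw with <-cmp (toℕ u) (toℕ w)
  ... | tri< u<w _ _ = edges-strict-< S⊆T u w u<w Suw Tuw
  ... | tri≈ _ u≡w _ = ⊥-elim (u≢w (FinP.toℕ-injective u≡w))
  ... | tri> _ _ w<u = edges-strict-< S⊆T w u w<u
    (trans (inducedEdge-sym S w u) Suw) (trans (inducedEdge-sym T w u) Tuw)

  edges-insert : ∀ S p q → S p ≡ false → S q ≡ true → Adj q p → edges S < edges (insert p S)
  edges-insert S p q Sp Sq qp =
    edges-strict (insert-⊇ S p) q p (adj⇒≢ qp) old new
    where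
    old : inducedEdge S q p ≡ false
    old rewrite Sq | Sp = refl
    new : inducedEdge (insert p S) q p ≡ true
    new rewrite Sq | Sp | ==-refl p = qp

  -- Adding a path P outside S whose first vertex has a neighbour in S adds at least
  -- |P| edges: each vertex of P is joined to its predecessor.
  edges-path : ∀ S T q p ps → S q ≡ true → Adj q p → Walk Adj p ps → Unique (p ∷ ps)
    → (∀ {t} → t ∈ p ∷ ps → S t ≡ false) → S ⊆ T → (p ∷ ps) within T
    → edges S + length (p ∷ ps) ≤ edges T
  edges-path S T q p [] Sq qp _ _ outside S⊆T P⊆T = begin
    edges S + 1              ≡⟨ +-comm (edges S) 1 ⟩
    suc (edges S)            ≤⟨ edges-insert S p q (outside (here refl)) Sq qp ⟩
    edges (insert p S)       ≤⟨ edges-mono (insert-⊆ S⊆T (P⊆T (here refl))) ⟩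
    edges T                  ∎
    where open ≤-Reasoning
  edges-path S T q p (r ∷ rs) Sq qp (pr , walk) (p∉ ∷ uniq) outside S⊆T P⊆T = begin
    edges S + suc (length (r ∷ rs))     ≡⟨ +-suc (edges S) _ ⟩
    suc (edges S) + length (r ∷ rs)     ≤⟨ +-monoˡ-≤ _ (edges-insert S p q (outside (here refl)) Sq qp) ⟩
    edges (insert p S) + length (r ∷ rs) ≤⟨ edges-path (insert p S) T p r rs (insert-∋ S p) pr walk uniq
                                             outside′ (insert-⊆ S⊆T (P⊆T (here refl))) (P⊆T ∘ there) ⟩
    edges T                             ∎
    where
    open ≤-Reasoning
    outside′ : ∀ {t} → t ∈ r ∷ rs → insert p S t ≡ false
    outside′ {t} t∈ rewrite outside (there t∈) = dec-false (p Fin.≟ t) (All.lookup p∉ t∈)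

  isPair : Fin n → Fin n → Fin n → Fin n → Bool
  isPair a b u w = (a == u ∧ b == w) ∨ (a == w ∧ b == u)

  isPair⇒ : ∀ a b u w → isPair a b u w ≡ true → (a ≡ u × b ≡ w) ⊎ (a ≡ w × b ≡ u)
  isPair⇒ a b u w e with a == u in au | b == w in bw | a == w in aw | b == u in bu
  ... | true  | true  | _    | _    = inj₁ (==⇒≡ {u = a} au , ==⇒≡ {u = b} bw)
  ... | true  | false | true | true = inj₂ (==⇒≡ {u = a} aw , ==⇒≡ {u = b} bu)
  ... | false | _     | true | true = inj₂ (==⇒≡ {u = a} aw , ==⇒≡ {u = b} bu)

  isPair-sym : ∀ a b u w → isPair a b u w ≡ isPair b a u w
  isPair-sym a b u w
    rewrite ∧-comm (a == u) (b == w) | ∧-comm (a == w) (b == u) = ∨-comm (b == w ∧ a == u) _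

  pair-count-< : ∀ a b → toℕ a < toℕ b
    → sumFin (λ u → count (λ w → (u ≺ w) ∧ isPair a b u w)) ≡ 1
  pair-count-< a b a<b = count₂-single _ a b only present
    where
    only : ∀ u w → (u ≺ w) ∧ isPair a b u w ≡ true → u ≡ a × w ≡ b
    only u w e with isPair⇒ a b u w (∧-conicalʳ _ _ e)
    ... | inj₁ (refl , refl) = refl , refl
    ... | inj₂ (refl , refl) =
      ⊥-elim (<-asym a<b (<ᵇ⇒< (toℕ b) (toℕ a) (from T-≡ (∧-conicalˡ _ _ e))))
    present : (a ≺ b) ∧ isPair a b a b ≡ true
    present rewrite to T-≡ (<⇒<ᵇ a<b) | ==-refl a | ==-refl b = refl

  pair-count : ∀ a b → a ≢ b → sumFin (λ u → count (λ w → (u ≺ w) ∧ isPair a b u w)) ≡ 1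
  pair-count a b a≢b with <-cmp (toℕ a) (toℕ b)
  ... | tri< a<b _ _ = pair-count-< a b a<b
  ... | tri≈ _ a≡b _ = ⊥-elim (a≢b (FinP.toℕ-injective a≡b))
  ... | tri> _ _ b<a = trans
    (sumFin-cong (λ u → sumFin-cong (λ w → cong (λ z → ind ((u ≺ w) ∧ z)) (isPair-sym a b u w))))
    (pair-count-< b a b<a)

  inC-vert : ∀ (C : Cycle G) i → inC C (vert C i) ≡ true
  inC-vert C i = ∃⇒anyFin (λ j → vert C j == vert C i) i (==-refl (vert C i))

  inC⇒vert : ∀ (C : Cycle G) {t} → inC C t ≡ true → ∃ λ i → vert C i ≡ t
  inC⇒vert C {t} e = let i , e′ = anyFin⇒∃ (λ j → vert C j == t) e in i , ==⇒≡ e′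

  cycleEdges : Cycle G → ℕ
  cycleEdges C = sumFin (λ u → count (λ w → (u ≺ w) ∧ cycEdge C u w))

  cycle-edges-distinct : ∀ (C : Cycle G) i j u w → i ≢ j
    → isPair (vert C i) (vert C (next i)) u w ≡ true → isPair (vert C j) (vert C (next j)) u w ≡ false
  cycle-edges-distinct C i j u w i≢j ei = ¬-not λ ej →
    orientations (isPair⇒ _ _ u w ei) (isPair⇒ _ _ u w ej)
    where
    v = vert C
    twice-next≢ : ∀ k → next (next k) ≢ k
    twice-next≢ = next-next≢ (s≤s (s≤s z≤n))
    orientations : (v i ≡ u × v (next i) ≡ w) ⊎ (v i ≡ w × v (next i) ≡ u)
          → (v j ≡ u × v (next j) ≡ w) ⊎ (v j ≡ w × v (next j) ≡ u) → ⊥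
    orientations (inj₁ (iu , _))   (inj₁ (ju , _))   = i≢j (inj C (trans iu (sym ju)))
    orientations (inj₂ (iw , _))   (inj₂ (jw , _))   = i≢j (inj C (trans iw (sym jw)))
    orientations (inj₁ (iu , i⁺w)) (inj₂ (jw , j⁺u)) =
      twice-next≢ j (trans (cong next (inj C (trans j⁺u (sym iu)))) (inj C (trans i⁺w (sym jw))))
    orientations (inj₂ (iw , i⁺u)) (inj₁ (ju , j⁺w)) =
      twice-next≢ j (trans (cong next (inj C (trans j⁺w (sym iw)))) (inj C (trans i⁺u (sym ju))))

  cycleEdges≡length : ∀ (C : Cycle G) → cycleEdges C ≡ 3 + len C
  cycleEdges≡length C = begin
    cycleEdges C
      ≡⟨ sumFin-cong (λ u → sumFin-cong (λ w → cong ind (∧-anyFin (u ≺ w) (λ i → e i u w)))) ⟩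
    sumFin (λ u → count (λ w → anyFin (λ i → (u ≺ w) ∧ e i u w)))
      ≡⟨ sumFin-cong (λ u → count-⋁ (λ i w → (u ≺ w) ∧ e i u w) (disjoint u)) ⟩
    sumFin (λ u → sumFin (λ i → count (λ w → (u ≺ w) ∧ e i u w)))
      ≡⟨ sumFin-swap (λ u i → count (λ w → (u ≺ w) ∧ e i u w)) ⟩
    sumFin (λ i → sumFin (λ u → count (λ w → (u ≺ w) ∧ e i u w)))
      ≡⟨ sumFin-cong (λ i → pair-count (vert C i) (vert C (next i)) (adj⇒≢ (edge C i))) ⟩
    sumFin {3 + len C} (λ _ → 1)
      ≡⟨ sumFin-ones (3 + len C) ⟩
    3 + len C ∎
    where
    open ≡-Reasoning
    e : Fin (3 + len C) → Fin n → Fin n → Bool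
    e i = isPair (vert C i) (vert C (next i))
    disjoint : ∀ u i j w → i ≢ j → (u ≺ w) ∧ e i u w ≡ true → (u ≺ w) ∧ e j u w ≡ false
    disjoint u i j w i≢j ei = trans
      (cong ((u ≺ w) ∧_) (cycle-edges-distinct C i j u w i≢j (∧-conicalʳ (u ≺ w) _ ei)))
      (∧-zeroʳ _)

  cycEdge⇒inducedEdge : ∀ (C : Cycle G) u w → cycEdge C u w ≡ true → inducedEdge (inC C) u w ≡ true
  cycEdge⇒inducedEdge C u w e with anyFin⇒∃ _ e
  ... | i , ei with isPair⇒ (vert C i) (vert C (next i)) u w ei
  ...   | inj₁ (refl , refl) rewrite inC-vert C i | inC-vert C (next i) = edge C i
  ...   | inj₂ (refl , refl) rewrite inC-vert C i | inC-vert C (next i) = adj-sym (edge C i)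

  chords+cycleEdges : ∀ (C : Cycle G) → chords C + cycleEdges C ≡ edges (inC C)
  chords+cycleEdges C = trans (sym (sumFin-+ {n} _ _))
    (sumFin-cong (λ u → trans (sym (sumFin-+ {n} _ _)) (sumFin-cong (λ w → split u w))))
    where
    split : ∀ u w
      → ind ((u ≺ w) ∧ inC C u ∧ inC C w ∧ E G u w ∧ not (cycEdge C u w))
        + ind ((u ≺ w) ∧ cycEdge C u w)
      ≡ ind ((u ≺ w) ∧ inducedEdge (inC C) u w)
    split u w with inC C u | inC C w | E G u w | cycEdge⇒inducedEdge C u w
    ... | true  | true  | true  | ce⇒ = ind-split (u ≺ w) true  (cycEdge C u w) ce⇒
    ... | true  | true  | false | ce⇒ = ind-split (u ≺ w) false (cycEdge C u w) ce⇒
    ... | true  | false | _     | ce⇒ = ind-split (u ≺ w) false (cycEdge C u w) ce⇒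
    ... | false | _     | _     | ce⇒ = ind-split (u ≺ w) false (cycEdge C u w) ce⇒

  chords+length : ∀ (C : Cycle G) → chords C + (3 + len C) ≡ edges (inC C)
  chords+length C = trans (cong (chords C +_) (sym (cycleEdges≡length C))) (chords+cycleEdges C)

  size-cycle : ∀ (C : Cycle G) → count (inC C) ≡ 3 + len C
  size-cycle C = begin
    count (inC C)                 ≡⟨ sumFin-cong (λ w → cong ind (sym (∧-identityʳ (inC C w)))) ⟩
    count (λ w → inC C w ∧ true)  ≡⟨ count-image (vert C) (inj C) (λ _ → true) ⟩
    sumFin {3 + len C} (λ _ → 1)  ≡⟨ sumFin-ones (3 + len C) ⟩
    3 + len C                     ∎
    where open ≡-Reasoning

  Walk-lookup : ∀ a xs → Walk Adj a xs → (i j : Fin (suc (length xs)))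
    → toℕ j ≡ suc (toℕ i) → Adj (lookup (a ∷ xs) i) (lookup (a ∷ xs) j)
  Walk-lookup a (x ∷ xs) (ax , _)    zero    (suc zero)    _ = ax
  Walk-lookup a (x ∷ xs) (_  , walk) (suc i) (suc j)       e = Walk-lookup x xs walk i j (suc-injective e)
  Walk-lookup a (x ∷ xs) _           zero    (suc (suc j)) ()
  Walk-lookup a (x ∷ xs) _           (suc i) zero          ()

  lookup-last : ∀ (a : Fin n) xs (i : Fin (suc (length xs))) → toℕ i ≡ length xs
    → lookup (a ∷ xs) i ≡ end a xs
  lookup-last a []       zero    _ = refl
  lookup-last a (x ∷ xs) (suc i) e = lookup-last x xs i (suc-injective e)

  closedWalk→cycle : ∀ l ls → 2 ≤ length ls → Walk Adj l ls → Adj (end l ls) l → Unique (l ∷ ls)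
    → Cycle G
  closedWalk→cycle l []             ()
  closedWalk→cycle l (_ ∷ [])       (s≤s ())
  closedWalk→cycle l ls@(_ ∷ _ ∷ rest) _ walk close uniq = record
    { len  = length rest
    ; vert = lookup (l ∷ ls)
    ; inj  = λ {i} {j} → lookup-injective uniq i j
    ; edge = consecutive
    }
    where
    consecutive : ∀ i → Adj (lookup (l ∷ ls) i) (lookup (l ∷ ls) (next i))
    consecutive i with next-cases i
    ... | inj₁ (last , i⁺≡0) rewrite i⁺≡0 | lookup-last l ls i last = close
    ... | inj₂ (_ , i⁺)                  = Walk-lookup l ls walk i (next i) i⁺

  closedWalk-length : ∀ l ls ls≥2 walk close uniq
    → 3 + len (closedWalk→cycle l ls ls≥2 walk close uniq) ≡ length (l ∷ ls)
  closedWalk-length l []             ()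
  closedWalk-length l (_ ∷ [])       (s≤s ())
  closedWalk-length l (_ ∷ _ ∷ rest) _ _ _ _ = refl

  closedWalk-vertices : ∀ l ls ls≥2 walk close uniq t
    → inC (closedWalk→cycle l ls ls≥2 walk close uniq) t ≡ true ⇔ t ∈ l ∷ ls
  closedWalk-vertices l []             ()
  closedWalk-vertices l (_ ∷ [])       (s≤s ())
  closedWalk-vertices l ls@(_ ∷ _ ∷ _) ls≥2 walk close uniq t = mk⇔
    (λ e → let i , lookup≡t = inC⇒vert C e in subst (_∈ l ∷ ls) lookup≡t (∈-lookup i))
    (λ t∈ → subst (λ z → inC C z ≡ true) (sym (lookup-index t∈)) (inC-vert C (Any.index t∈)))
    where
    C = closedWalk→cycle l ls ls≥2 walk close uniq

  vertices : Cycle G → List (Fin n)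
  vertices C = tabulate (vert C)

  vertices-unique : ∀ (C : Cycle G) → Unique (vertices C)
  vertices-unique C = UniqueP.tabulate⁺ {f = vert C} (inj C)

  length-vertices : ∀ (C : Cycle G) → length (vertices C) ≡ 3 + len C
  length-vertices C = ListP.length-tabulate (vert C)

  ∈-vertices : ∀ (C : Cycle G) t → inC C t ≡ true ⇔ t ∈ vertices C
  ∈-vertices C t = mk⇔
    (λ e → let i , vi≡t = inC⇒vert C e in subst (_∈ vertices C) vi≡t (∈-tabulate⁺ {f = vert C} i))
    (λ t∈ → let i , t≡vi = ∈-tabulate⁻ {f = vert C} t∈ in
      subst (λ z → inC C z ≡ true) (sym t≡vi) (inC-vert C i))

  -- A closed walk passing exactly once through each
  -- vertex of C and of P is a cycle C′ with V(C′) = V(C) ∪ V(P) and at least as many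
  -- chords as C: G[V(C′)] has the edges of G[V(C)] plus, for each vertex of P, the edge
  -- to its predecessor (edges-path), while C′ has only |P| more cycle edges than C.
  absorb : ∀ (C : Cycle G) q p ps l ls
    → inC C q ≡ true → Adj q p → Walk Adj p ps → Unique (p ∷ ps)
    → (∀ {t} → t ∈ p ∷ ps → inC C t ≡ false)
    → Walk Adj l ls → Adj (end l ls) l → l ∷ ls ↭ vertices C ++ p ∷ ps
    → Σ (Cycle G) λ C′ → (∀ t → inC C′ t ≡ true ⇔ t ∈ vertices C ++ p ∷ ps) × chords C ≤ chords C′
  absorb C q p ps l ls Cq qp walkP uniqP outside walk close W↭ = C′ , V[C′] , more-chords
    where
    P = p ∷ ps
    N = 3 + len C
    length-W : length (l ∷ ls) ≡ N + length P
    length-W = trans (↭-length W↭)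
      (trans (ListP.length-++ (vertices C)) (cong (_+ length P) (length-vertices C)))
    ls≥2 : 2 ≤ length ls
    ls≥2 = subst (2 ≤_) (sym (suc-injective length-W)) (s≤s (s≤s z≤n))
    uniq : Unique (l ∷ ls)
    uniq = Unique-resp-↭ (↭-sym W↭) (UniqueP.++⁺ (vertices-unique C) uniqP
      (λ (t∈C , t∈P) → true≢false (trans (sym (from (∈-vertices C _) t∈C)) (outside t∈P))))
    C′ = closedWalk→cycle l ls ls≥2 walk close uniq
    V[C′] : ∀ t → inC C′ t ≡ true ⇔ t ∈ vertices C ++ P
    V[C′] t = mk⇔
      (λ e → ∈-resp-↭ W↭ (to (closedWalk-vertices l ls ls≥2 walk close uniq t) e))
      (λ t∈ → from (closedWalk-vertices l ls ls≥2 walk close uniq t) (∈-resp-↭ (↭-sym W↭) t∈))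
    C⊆C′ : inC C ⊆ inC C′
    C⊆C′ t e = from (V[C′] t) (∈-++⁺ˡ (to (∈-vertices C t) e))
    more-chords : chords C ≤ chords C′
    more-chords = +-cancelʳ-≤ (N + length P) (chords C) (chords C′) (begin
      chords C + (N + length P)   ≡⟨ sym (+-assoc (chords C) N (length P)) ⟩
      chords C + N + length P     ≡⟨ cong (_+ length P) (chords+length C) ⟩
      edges (inC C) + length P    ≤⟨ edges-path (inC C) (inC C′) q p ps Cq qp walkP uniqP outside C⊆C′
                                       (λ {t} t∈ → from (V[C′] t) (∈-++⁺ʳ (vertices C) t∈)) ⟩
      edges (inC C′)              ≡⟨ sym (chords+length C′) ⟩
      chords C′ + (3 + len C′)    ≡⟨ cong (chords C′ +_)
                                       (trans (closedWalk-length l ls ls≥2 walk close uniq) length-W) ⟩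
      chords C′ + (N + length P)  ∎)
      where open ≤-Reasoning

  Succ : Cycle G → Fin n → Fin n → Set
  Succ C u w = ∃ λ i → vert C i ≡ u × vert C (next i) ≡ w

  succ⇒adj : ∀ {C u w} → Succ C u w → Adj u w
  succ⇒adj {C} (i , refl , refl) = edge C i

  pred-unique : ∀ C {x} a → Succ C x (vert C (next a)) → x ≡ vert C a
  pred-unique C a (i , refl , e) = cong (vert C) (next-injective (inj C e))

  succ-unique : ∀ C {z} b → Succ C (vert C b) z → z ≡ vert C (next b)
  succ-unique C b (i , e , refl) = cong (vert C ∘ next) (inj C e)

  Rotation : (C : Cycle G) → Fin (3 + len C) → Set
  Rotation C s = Σ (List (Fin n)) λ rs →
    Walk (Succ C) (vert C s) rs × Succ C (end (vert C s) rs) (vert C s) × (vert C s ∷ rs ↭ vertices C)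

  rotation : ∀ C s → Rotation C s
  rotation C zero    = tail , around , close , ↭-refl
    where
    tail   = tabulate (vert C ∘ suc)
    around = Walk-tabulate (vert C) (λ j → Fin.inject₁ j , refl , cong (vert C) (next-inject₁ j))
    close  = Fin.fromℕ _ , sym (end-tabulate (vert C)) , cong (vert C) (next-fromℕ _)
  rotation C (suc s) with ∈-∃++ (∈-tabulate⁺ {f = vert C ∘ suc} s)
  ... | as , zs , tail≡ = zs ++ a ∷ as , proj₁ rotated , proj₂ rotated
    , subst (λ xs → b ∷ zs ++ a ∷ as ↭ a ∷ xs) (sym tail≡) (++-comm (b ∷ zs) (a ∷ as))
    where
    a = vert C zero
    b = vert C (suc s)
    from-start = rotation C zero
    walk : Walk (Succ C) a (as ++ b ∷ zs)
    walk = subst (Walk (Succ C) a) tail≡ (proj₁ (proj₂ from-start))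
    close : Succ C (end a (as ++ b ∷ zs)) a
    close = subst (λ xs → Succ C (end a xs) a) tail≡ (proj₁ (proj₂ (proj₂ from-start)))
    rotated = rotate a as b zs walk close

module Extremal {k c n : ℕ} (G : Graph n) (L : Fin n → Bool)
  (F : Fin k → Cycle G) (family : Family k c F)
  (maximal : ∀ (F′ : Fin k → Cycle G) → Family k c F′
    → (scoreL L F′ ≤ scoreL L F) × (scoreL L F′ ≡ scoreL L F → size F′ ≤ size F))
  (H : Fin n → Bool) (component : IsComponent {G = G} (λ v → not (inStar F v)) H)
  (p : Fin k) where

  open GraphFacts G

  C : Cycle G
  C = F p

  H⊆H* : ∀ {t} → H t ≡ true → inStar F t ≡ false
  H⊆H* {t} Ht with inStar F t | proj₁ (proj₂ component) t Ht
  ... | false | _ = refl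

  H*-avoids : ∀ {t} q → inStar F t ≡ false → inC (F q) t ≡ false
  H*-avoids {t} q outside =
    ¬-not (λ inFq → true≢false (trans (sym (∃⇒anyFin (λ q → inC (F q) t) q inFq)) outside))

  module Replace (C′ : Cycle G) (chorded : Chorded c C′) (C⊆C′ : inC C ⊆ inC C′)
    (C′⊆C∪H : ∀ t → inC C′ t ≡ true → inC C t ≡ true ⊎ H t ≡ true) where

    F′ : Fin k → Cycle G
    F′ q with p Fin.≟ q
    ... | yes _ = C′
    ... | no  _ = F q

    F′-family : Family k c F′
    F′-family = chorded′ , disjoint′
      where
      chorded′ : ∀ q → Chorded c (F′ q)
      chorded′ q with p Fin.≟ q
      ... | yes _ = chorded
      ... | no  _ = proj₁ family q
      C′-avoids : ∀ q → p ≢ q → ∀ v → inC C′ v ≡ true → inC (F q) v ≡ false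
      C′-avoids q p≢q v C′v with C′⊆C∪H v C′v
      ... | inj₁ Cv = proj₂ family p q p≢q v Cv
      ... | inj₂ Hv = H*-avoids q (H⊆H* Hv)
      disjoint′ : ∀ q₁ q₂ → q₁ ≢ q₂ → ∀ v → inC (F′ q₁) v ≡ true → inC (F′ q₂) v ≡ false
      disjoint′ q₁ q₂ q₁≢q₂ v e with p Fin.≟ q₁ | p Fin.≟ q₂
      ... | yes refl | yes refl = ⊥-elim (q₁≢q₂ refl)
      ... | yes refl | no p≢q₂  = C′-avoids q₂ p≢q₂ v e
      ... | no p≢q₁  | yes refl = ¬-not (λ C′v → true≢false (trans (sym e) (C′-avoids q₁ p≢q₁ v C′v)))
      ... | no _     | no _     = proj₂ family q₁ q₂ q₁≢q₂ v e

    F′-covers : ∀ q → inC (F q) ⊆ inC (F′ q)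
    F′-covers q with p Fin.≟ q
    ... | yes refl = C⊆C′
    ... | no  _    = λ _ e → e

    F′-covers-C′ : inC C′ ⊆ inC (F′ p)
    F′-covers-C′ with p Fin.≟ p
    ... | yes _  = λ _ e → e
    ... | no p≢p = ⊥-elim (p≢p refl)

    star-grows : inStar F ⊆ inStar F′
    star-grows t e = let q , Fq∋t = anyFin⇒∃ (λ q → inC (F q) t) e in
      ∃⇒anyFin (λ q → inC (F′ q) t) q (F′-covers q t Fq∋t)

  -- Hence no such C′ can contain a vertex of H: it would cover the same vertices of L
  -- (so (A1) ties) and strictly more vertices (contradicting (A2)).
  no-enlargement : ∀ (C′ : Cycle G) → Chorded c C′ → inC C ⊆ inC C′
    → (∀ t → inC C′ t ≡ true → inC C t ≡ true ⊎ H t ≡ true)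
    → ∀ h → H h ≡ true → inC C′ h ≡ true → ⊥
  no-enlargement C′ chorded C⊆C′ C′⊆C∪H h Hh C′h =
    <-irrefl refl (≤-trans more-vertices (proj₂ (maximal F′ F′-family) same-score))
    where
    open Replace C′ chorded C⊆C′ C′⊆C∪H
    same-score : scoreL L F′ ≡ scoreL L F
    same-score = ≤-antisym (proj₁ (maximal F′ F′-family))
      (count-mono _ _ (λ t e → ∧-monoˡ (L t) (star-grows t) e))
    more-vertices : size F < size F′
    more-vertices = sumFin-strict (λ t → ind-mono (star-grows t)) h new
      where
      new : ind (inStar F h) < ind (inStar F′ h)
      new rewrite H⊆H* Hh | ∃⇒anyFin (λ q → inC (F′ q) h) p (F′-covers-C′ h C′h) = ≤-refl

  no-absorption : ∀ q a ps l ls → inC C q ≡ true → Adj q a → Walk Adj a ps → Unique (a ∷ ps)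
    → (a ∷ ps) within H → Walk Adj l ls → Adj (end l ls) l → l ∷ ls ↭ vertices C ++ a ∷ ps → ⊥
  no-absorption q a ps l ls Cq qa walkP uniqP P⊆H walk close W↭ =
    no-enlargement C′ (≤-trans (proj₁ family p) more-chords) C⊆C′ C′⊆C∪H a (P⊆H (here refl))
      (from (V[C′] a) (∈-++⁺ʳ (vertices C) (here refl)))
    where
    outside : ∀ {t} → t ∈ a ∷ ps → inC C t ≡ false
    outside t∈ = H*-avoids p (H⊆H* (P⊆H t∈))
    absorbed = absorb C q a ps l ls Cq qa walkP uniqP outside walk close W↭
    C′ = proj₁ absorbed
    V[C′] = proj₁ (proj₂ absorbed)
    more-chords = proj₂ (proj₂ absorbed)
    C⊆C′ : inC C ⊆ inC C′
    C⊆C′ t Ct = from (V[C′] t) (∈-++⁺ˡ (to (∈-vertices C t) Ct))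
    C′⊆C∪H : ∀ t → inC C′ t ≡ true → inC C t ≡ true ⊎ H t ≡ true
    C′⊆C∪H t C′t with ∈-++⁻ (vertices C) (to (V[C′] t) C′t)
    ... | inj₁ t∈C = inj₁ (from (∈-vertices C t) t∈C)
    ... | inj₂ t∈P = inj₂ (P⊆H t∈P)

  H-path : ∀ {a b} → H a ≡ true → H b ≡ true → Path H a b
  H-path Ha Hb = loop-erase (proj₁ (proj₂ (proj₂ component)) _ _ Ha Hb)

  -- Part (i): if v = vert C j has a neighbour a in H, no vertex b of H is adjacent to v⁺;
  -- otherwise v⁺, …, v (around C), a, (path in H), b, v⁺ would absorb a path of H.
  successor-avoids-H : ∀ j a b → H a ≡ true → H b ≡ true
    → Adj (vert C j) a → Adj b (vert C (next j)) → ⊥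
  successor-avoids-H j a b Ha Hb va bv⁺ with H-path Ha Hb | rotation C (next j)
  ... | ps , walkP , endP , uniqP , P⊆H | rs , around , close , rot↭ =
    no-absorption (vert C j) a ps v⁺ (rs ++ a ∷ ps) (inC-vert C j) va walkP uniqP P⊆H
      walk close′ (++⁺ʳ (a ∷ ps) rot↭)
    where
    v⁺ = vert C (next j)
    walk : Walk Adj v⁺ (rs ++ a ∷ ps)
    walk = Walk-++ v⁺ rs (a ∷ ps) (Walk-map (succ⇒adj {C}) v⁺ rs around)
      (subst (λ z → Adj z a) (sym (pred-unique C j close)) va , walkP)
    close′ : Adj (end v⁺ (rs ++ a ∷ ps)) v⁺
    close′ = subst (λ z → Adj z v⁺) (sym (trans (end-++ v⁺ rs (a ∷ ps)) endP)) bv⁺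

  -- For positions i ≠ j of C such that vert C i has a neighbour h in H and vert C j a
  -- neighbour x in H, the successors of vert C i and vert C j are not adjacent;
  -- otherwise i⁺, …, j (around C), x, (path in H), h, i, …, j⁺ (backwards around C), i⁺
  -- would absorb a path of H.
  successors-nonadjacent : ∀ i j x h → i ≢ j → H x ≡ true → H h ≡ true
    → Adj (vert C j) x → Adj h (vert C i) → Adj (vert C (next i)) (vert C (next j)) → ⊥
  successors-nonadjacent i j x h i≢j Hx Hh jx hi i⁺j⁺ with H-path Hx Hh | rotation C (next i)
  ... | ps , walkP , endP , uniqP , P⊆H | rs , around , close , rot↭
    with split-at (vert C (next i)) rs (∈-resp-↭ (↭-sym rot↭) (∈-tabulate⁺ {f = vert C} j))
  ...   | as , [] , refl , as-ends =
    i≢j (inj C (trans (sym (pred-unique C i close))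
                      (trans (cong (end _) (ListP.++-identityʳ as)) as-ends)))
  ...   | as , z ∷ zs , refl , as-ends =
    no-absorption (vert C j) x ps i⁺ (as ++ (x ∷ ps) ++ reverse (z ∷ zs)) (inC-vert C j) jx walkP uniqP P⊆H
      walk close′ (↭-trans (splice-↭ i⁺ as (x ∷ ps) (z ∷ zs)) (++⁺ʳ (x ∷ ps) rot↭))
    where
    i⁺ = vert C (next i)
    pieces = Walk-++⁻ i⁺ as (z ∷ zs) around
    z≡j⁺ : z ≡ vert C (next j)
    z≡j⁺ = succ-unique C j (subst (λ y → Succ C y z) as-ends (proj₁ (proj₂ pieces)))
    zs-ends : end z zs ≡ vert C i
    zs-ends = trans (sym (end-++ i⁺ as (z ∷ zs))) (pred-unique C i close)
    back : Walk Adj (end x ps) (reverse (z ∷ zs))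
    back = Walk-reverse adj-sym (end x ps) z zs (Walk-map (succ⇒adj {C}) z zs (proj₂ (proj₂ pieces)))
      (subst₂ Adj (sym endP) (sym zs-ends) hi)
    walk : Walk Adj i⁺ (as ++ (x ∷ ps) ++ reverse (z ∷ zs))
    walk = Walk-++ i⁺ as _ (Walk-map (succ⇒adj {C}) i⁺ as (proj₁ pieces))
      (subst (λ y → Adj y x) (sym as-ends) jx , Walk-++ x ps (reverse (z ∷ zs)) walkP back)
    close′ : Adj (end i⁺ (as ++ (x ∷ ps) ++ reverse (z ∷ zs))) i⁺
    close′ = subst (λ y → Adj y i⁺)
      (sym (trans (end-++ i⁺ as _)
             (trans (end-++ x ps (reverse (z ∷ zs))) (trans (end-reverse _ z zs) z≡j⁺))))
      (adj-sym i⁺j⁺)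

  H* : Fin n → Bool
  H* w = not (inStar F w)

  H*-avoids-C : ∀ w → H* w ≡ true → inC C w ≡ false
  H*-avoids-C w H*w = H*-avoids p (not-injective H*w)

  size-split : count (λ w → H* w ∨ inC C w) ≡ count H* + count (inC C)
  size-split = count-∨ H* (inC C) H*-avoids-C

  deg-split : ∀ y → deg {G = G} (λ w → H* w ∨ inC C w) y ≡ deg {G = G} H* y + deg {G = G} (inC C) y
  deg-split y = trans (sumFin-cong (λ w → cong ind (∧-distribʳ-∨ (E G y w) (H* w) (inC C w))))
    (count-∨ (λ w → H* w ∧ E G y w) (λ w → inC C w ∧ E G y w) disjoint)
    where
    disjoint : ∀ w → H* w ∧ E G y w ≡ true → inC C w ∧ E G y w ≡ false
    disjoint w e rewrite H*-avoids-C w (∧-conicalˡ _ _ e) = refl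

  -- Inside H*: a vertex y with no neighbour in H and a vertex x of H have no common
  -- neighbour in H* (the H*-neighbours of x lie in H), and x is adjacent to neither;
  -- so their degrees into H* sum to less than |H*|.
  H*-bound : ∀ y x → (∀ w → H w ≡ true → E G y w ≡ false) → H x ≡ true
    → deg {G = G} H* y + deg {G = G} H* x < count H*
  H*-bound y x y≁H Hx = subst (_< count H*) (sumFin-+ {n} _ _) (sumFin-strict exclusive x x-alone)
    where
    exclusive : ∀ w → ind (H* w ∧ E G y w) + ind (H* w ∧ E G x w) ≤ ind (H* w)
    exclusive w with H* w in H*w | H w in Hw
    ... | false | _     = z≤n
    ... | true  | true  rewrite y≁H w Hw = ind≤1 (E G x w)
    ... | true  | false with E G x w in xw
    ...   | true  = ⊥-elim (true≢false (trans (sym (proj₂ (proj₂ (proj₂ component)) x w Hx H*w xw)) Hw))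
    ...   | false = ≤-trans (≤-reflexive (+-identityʳ _)) (ind≤1 (E G y w))
    x-alone : ind (H* x ∧ E G y x) + ind (H* x ∧ E G x x) < ind (H* x)
    x-alone rewrite H⊆H* Hx | y≁H x Hx | irrefl G x = ≤-refl

  -- On C: for each position j, x ~ vert C j and v⁺ ~ vert C (next j) exclude each other,
  -- where v⁺ = vert C (next i) and vert C i has a neighbour h in H (for j = i, v⁺ is not
  -- its own neighbour; for j ≠ i use successors-nonadjacent).  Summing over the
  -- positions j, the degrees of v⁺ and x into V(C) sum to at most |V(C)|.
  C-bound : ∀ i h x → H h ≡ true → Adj (vert C i) h → H x ≡ true
    → deg {G = G} (inC C) (vert C (next i)) + deg {G = G} (inC C) x ≤ count (inC C)
  C-bound i h x Hh ih Hx = begin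
    deg {G = G} (inC C) v⁺ + deg {G = G} (inC C) x
      ≡⟨ cong₂ _+_ deg-v⁺ (count-image (vert C) (inj C) (E G x)) ⟩
    count (λ j → E G v⁺ (vert C (next j))) + count (λ j → E G x (vert C j))
      ≡⟨ +-comm (count (λ j → E G v⁺ (vert C (next j)))) _ ⟩
    count (λ j → E G x (vert C j)) + count (λ j → E G v⁺ (vert C (next j)))
      ≡⟨ sym (sumFin-+ (λ j → ind (E G x (vert C j))) (λ j → ind (E G v⁺ (vert C (next j))))) ⟩
    sumFin (λ j → ind (E G x (vert C j)) + ind (E G v⁺ (vert C (next j))))
      ≤⟨ sumFin-mono exclusive ⟩
    sumFin {3 + len C} (λ _ → 1)
      ≡⟨ trans (sumFin-ones (3 + len C)) (sym (size-cycle C)) ⟩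
    count (inC C) ∎
    where
    open ≤-Reasoning
    v⁺ = vert C (next i)
    deg-v⁺ : deg {G = G} (inC C) v⁺ ≡ count (λ j → E G v⁺ (vert C (next j)))
    deg-v⁺ = trans
      (sumFin-cong (λ w → cong (λ b → ind (b ∧ E G v⁺ w))
        (sym (anyFin-surjective (λ j → vert C j == w) next next-surjective))))
      (count-image (vert C ∘ next) (next-injective ∘ inj C) (E G v⁺))
    exclusive : ∀ j → ind (E G x (vert C j)) + ind (E G v⁺ (vert C (next j))) ≤ 1
    exclusive j with E G x (vert C j) in xj
    ... | false = ind≤1 _
    ... | true with i Fin.≟ j
    ...   | yes refl rewrite irrefl G v⁺ = ≤-refl
    ...   | no i≢j with E G v⁺ (vert C (next j)) in i⁺j⁺
    ...     | false = ≤-refl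
    ...     | true  = ⊥-elim (successors-nonadjacent i j x h i≢j Hx Hh (adj-sym xj) (adj-sym ih) i⁺j⁺)


lemma2p1 : (k c n : ℕ) → 0 < k → 0 < c → (G : Graph n) → (L : Fin n → Bool)
  → (F : Fin k → Cycle G) → Family k c F
  → (∃ λ v → inStar F v ≡ false)
  → (∀ (F′ : Fin k → Cycle G) → Family k c F′
       → (scoreL L F′ ≤ scoreL L F) × (scoreL L F′ ≡ scoreL L F → size F′ ≤ size F))
  → (H : Fin n → Bool) → IsComponent {G = G} (λ v → not (inStar F v)) H
  → (p : Fin k) → (i : Fin (3 + len (F p)))
  → (∃ λ h → H h ≡ true × E G (vert (F p) i) h ≡ true)
  → (x : Fin n) → H x ≡ true
  → (E G (vert (F p) (next i)) x ≡ false)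
    × (deg {G = G} (λ w → not (inStar F w) ∨ inC (F p) w) (vert (F p) (next i))
       + deg {G = G} (λ w → not (inStar F w) ∨ inC (F p) w) x
       ≤ count (λ w → not (inStar F w) ∨ inC (F p) w) ∸ 1)
lemma2p1 k c n _ _ G L F family _ maximal H component p i (h , Hh , ih) x Hx =
  v⁺≁H x Hx , ∸-monoˡ-≤ 1 degree-sum
  where
  open Extremal G L F family maximal H component p
  open GraphFacts G using (adj-sym)
  v⁺ = vert C (next i)
  X : Fin n → Bool
  X w = H* w ∨ inC C w
  v⁺≁H : ∀ w → H w ≡ true → E G v⁺ w ≡ false
  v⁺≁H w Hw = ¬-not (λ v⁺w → successor-avoids-H i h w Hh Hw ih (adj-sym v⁺w))
  degree-sum : deg {G = G} X v⁺ + deg {G = G} X x < count X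
  degree-sum = begin-strict
    deg {G = G} X v⁺ + deg {G = G} X x
      ≡⟨ cong₂ _+_ (deg-split v⁺) (deg-split x) ⟩
    (deg {G = G} H* v⁺ + deg {G = G} (inC C) v⁺) + (deg {G = G} H* x + deg {G = G} (inC C) x)
      ≡⟨ interchange (deg {G = G} H* v⁺) _ _ _ ⟩
    (deg {G = G} H* v⁺ + deg {G = G} H* x) + (deg {G = G} (inC C) v⁺ + deg {G = G} (inC C) x)
      <⟨ +-mono-<-≤ (H*-bound v⁺ x v⁺≁H Hx) (C-bound i h x Hh ih Hx) ⟩
    count H* + count (inC C)
      ≡⟨ sym size-split ⟩
    count X ∎
    where open ≤-Reasoning
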